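{- (1) For all $x : B$ and all proofs $e_1, e_2 : \texttt{eventually\_dyn}\ x$, $\texttt{pre\_dyn}\ x\ e_1 = \texttt{pre\_dyn}\ x\ e_2$. (2) For all $x, x' : B$ and all proofs $i : \texttt{infinite\_dyn}\ x$, $i' : \texttt{infinite\_dyn}\ x'$, if $x = x'$ then $\texttt{bisimilar\_s}\ (\texttt{dyn}\ x\ i)\ (\texttt{dyn}\ x'\ i')$.
   Context: Work in Coq. Sets $A, B$; $P : B \to \texttt{bool}$; $h : B \to A$; $g, g' : B \to B$. Streams: \texttt{CoInductive str (A:Set) : Set := SCons : A -> str A -> str A.} Bisimilarity: \texttt{CoInductive bisimilar\_s : str A -> str A -> Prop := bisim : forall (a : A) (s s' : str A), bisimilar\_s s s' -> bisimilar\_s (SCons A a s) (SCons A a s').} \texttt{Inductive eventually\_dyn : B -> Prop := | ev\_dyn1 : forall x, P x = true -> eventually\_dyn x | ev\_dyn2 : forall x, P x = false -> eventually\_dyn (g' x) -> eventually\_dyn x.} \texttt{pre\_dyn : forall x, eventually\_dyn x -> A * B} is defined by structural recursion on the proof argument: \texttt{pre\_dyn x d} $= (h\,x, g\,x)$ if $P\,x = \texttt{true}$, and \texttt{pre\_dyn (g' x) d'} if $P\,x = \texttt{false}$, where \texttt{d'} is the structurally smaller sub-proof of \texttt{eventually\_dyn (g' x)} obtained by inversion of \texttt{d}. \texttt{CoInductive infinite\_dyn : B -> Prop := di : forall x (d : eventually\_dyn x), infinite\_dyn (snd (pre\_dyn x d)) -> infinite\_dyn x.} Let \texttt{infinite\_eventually\_dyn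 : forall x, infinite\_dyn x -> eventually\_dyn x} (extracting the component of \texttt{di}) and \texttt{infinite\_always\_dyn : forall x, infinite\_dyn x -> forall e : eventually\_dyn x, infinite\_dyn (snd (pre\_dyn x e))} be proofs of these statements. Then \texttt{CoFixpoint dyn (x:B) (i:infinite\_dyn x) : str A := SCons A (fst (pre\_dyn x (infinite\_eventually\_dyn x i))) (dyn \_ (infinite\_always\_dyn x i (infinite\_eventually\_dyn x i))).} (The omitted argument \_ is \texttt{snd (pre\_dyn x (infinite\_eventually\_dyn x i))}.) -}

module Defs where

open import Data.Nat using (ℕ; zero; suc)
open import Data.Bool using (Bool; true; false)
open import Data.Product using (Σ; _×_; _,_; proj₁; proj₂)
open import Relation.Binary.PropositionalEquality using (_≡_; refl)
open import Data.Sum using (_⊎_; inj₁; inj₂)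

Str : Set → Set
Str A = ℕ → A

hd : {A : Set} → Str A → A
hd s = s zero

tl : {A : Set} → Str A → Str A
tl s n = s (suc n)

SCons : {A : Set} → A → Str A → Str A
SCons a s zero    = a
SCons a s (suc n) = s n

-- CoInductive bisimilar_s : bisim : forall a s s',
--   bisimilar_s s s' -> bisimilar_s (SCons a s) (SCons a s').
-- Greatest fixed point of the corresponding monotone operator:
IsBisimulation : {A : Set} → (Str A → Str A → Set) → Set
IsBisimulation {A} R =
  ∀ (t t' : Str A) → R t t' → (hd t ≡ hd t') × R (tl t) (tl t')

Bisimilar : {A : Set} → Str A → Str A → Set₁
Bisimilar {A} s s' =
  Σ (Str A → Str A → Set) λ R → R s s' × IsBisimulation R

module Dyn {A B : Set} (P : B → Bool) (h : B → A) (g g' : B → B) where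

  data EventuallyDyn : B → Set where
    ev-dyn1 : ∀ x → P x ≡ true → EventuallyDyn x
    ev-dyn2 : ∀ x → P x ≡ false → EventuallyDyn (g' x) → EventuallyDyn x

  preDyn : ∀ x → EventuallyDyn x → A × B
  preDyn x (ev-dyn1 .x _)   = h x , g x
  preDyn x (ev-dyn2 .x _ d) = preDyn (g' x) d

  -- CoInductive infinite_dyn : di : forall x (d : eventually_dyn x),
  --   infinite_dyn (snd (pre_dyn x d)) -> infinite_dyn x.
  -- Greatest fixed point of the operator
  --   Φ(R)(x) = Σ (d : eventually_dyn x), R (snd (pre_dyn x d)).
  IsDynInvariant : (B → Set) → Set
  IsDynInvariant R =
    ∀ y → R y → Σ (EventuallyDyn y) λ d → R (proj₂ (preDyn y d))

  InfiniteDyn : B → Set₁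
  InfiniteDyn x = Σ (B → Set) λ R → R x × IsDynInvariant R

  -- the destructor of the coinductive type (inverse of di)
  infinite-eventually-dyn : ∀ x → InfiniteDyn x → EventuallyDyn x
  infinite-eventually-dyn x (R , rx , step) = proj₁ (step x rx)

  -- the constructor di (shows the encoding has the constructor of the Coq type)
  di : ∀ x (d : EventuallyDyn x) → InfiniteDyn (proj₂ (preDyn x d)) → InfiniteDyn x
  di x d (R , r , step) = (λ y → (y ≡ x) ⊎ R y) , inj₁ refl , step'
    where
      step' : IsDynInvariant (λ y → (y ≡ x) ⊎ R y)
      step' .x (inj₁ refl) = d , inj₂ r
      step' y (inj₂ ry) = proj₁ (step y ry) , inj₂ (proj₂ (step y ry))

  -- The type of infinite_always_dyn; dyn is defined relative to an
  -- arbitrary proof `always` of this statement (the lemma quantifies over it).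
  InfiniteAlways : Set₁
  InfiniteAlways = ∀ x → InfiniteDyn x → ∀ (e : EventuallyDyn x) →
                   InfiniteDyn (proj₂ (preDyn x e))

  -- CoFixpoint dyn x i := SCons (fst (pre_dyn x (ied x i)))
  --                             (dyn _ (always x i (ied x i)))
  dyn : InfiniteAlways → ∀ x → InfiniteDyn x → Str A
  dyn always x i zero    = proj₁ (preDyn x (infinite-eventually-dyn x i))
  dyn always x i (suc n) =
    dyn always (proj₂ (preDyn x (infinite-eventually-dyn x i)))
        (always x i (infinite-eventually-dyn x i)) n

-- (1) `preDyn x e` is computed by recursion on the proof `e`, but the
--     result is determined by `x` alone: two proofs of `EventuallyDyn x`
--     must use the same constructor, since their first fields fix whether
--     `P x` is `true` or `false`, and in the recursive case both continue at
--     the same point `g' x`.  Hence induction on the proofs shows that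
--     `preDyn` is proof-irrelevant.
-- (2) Streams are functions `ℕ → A`, and pointwise equality is a
--     bisimulation, so it suffices to show that `dyn always x i` and
--     `dyn always x' i'` agree at every index whenever `x ≡ x'`.  This goes
--     by induction on the index: the head is the first component of
--     `preDyn`, and the tail is `dyn` again at the second component of
--     `preDyn`; by (1) both components agree, so the induction hypothesis
--     applies to the tails.
module Submission where

open import Defs
open import Data.Bool using (Bool; true; false)
open import Data.Nat using (ℕ; zero; suc)
open import Data.Product using (_×_; _,_; proj₁; proj₂)
open import Relation.Binary.PropositionalEquality using (_≡_; refl; trans; sym; cong)

pointwise⇒bisimilar : {A : Set} {s s' : Str A} → (∀ n → s n ≡ s' n) → Bisimilar s s'
pointwise⇒bisimilar {A} s≗s' = Pointwise , s≗s' , pointwise-bisimulation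
  where
    Pointwise : Str A → Str A → Set
    Pointwise t t' = ∀ n → t n ≡ t' n

    pointwise-bisimulation : IsBisimulation Pointwise
    pointwise-bisimulation t t' t≗t' = t≗t' zero , λ n → t≗t' (suc n)

module _ {A B : Set} (P : B → Bool) (h : B → A) (g g' : B → B) where
  open Dyn P h g g'

  preDyn-irrelevant : (x : B) (e₁ e₂ : EventuallyDyn x) → preDyn x e₁ ≡ preDyn x e₂
  preDyn-irrelevant x (ev-dyn1 .x _)     (ev-dyn1 .x _)     = refl
  preDyn-irrelevant x (ev-dyn1 .x stop)  (ev-dyn2 .x go _)  with () ← trans (sym stop) go
  preDyn-irrelevant x (ev-dyn2 .x go _)  (ev-dyn1 .x stop)  with () ← trans (sym stop) go
  preDyn-irrelevant x (ev-dyn2 .x _ d₁)  (ev-dyn2 .x _ d₂)  = preDyn-irrelevant (g' x) d₁ d₂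

  dyn-pointwise : (always : InfiniteAlways) (n : ℕ) {x x' : B} → x ≡ x' →
                  (i : InfiniteDyn x) (i' : InfiniteDyn x') →
                  dyn always x i n ≡ dyn always x' i' n
  dyn-pointwise always zero {x} refl i i' =
    cong proj₁ (preDyn-irrelevant x (infinite-eventually-dyn x i) (infinite-eventually-dyn x i'))
  dyn-pointwise always (suc n) {x} refl i i' =
    dyn-pointwise always n
      (cong proj₂ (preDyn-irrelevant x (infinite-eventually-dyn x i) (infinite-eventually-dyn x i')))
      (always x i (infinite-eventually-dyn x i))
      (always x i' (infinite-eventually-dyn x i'))

lemma7p1 : {A B : Set} (P : B → Bool) (h : B → A) (g g' : B → B) →
    ((x : B) (e₁ e₂ : Dyn.EventuallyDyn P h g g' x) →
    Dyn.preDyn P h g g' x e₁ ≡ Dyn.preDyn P h g g' x e₂)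
    ×
    ((always : Dyn.InfiniteAlways P h g g') (x x' : B)
    (i : Dyn.InfiniteDyn P h g g' x) (i' : Dyn.InfiniteDyn P h g g' x') →
    x ≡ x' →
    Bisimilar (Dyn.dyn P h g g' always x i) (Dyn.dyn P h g g' always x' i'))
lemma7p1 P h g g' =
    preDyn-irrelevant P h g g'
  , λ always x x' i i' x≡x' →
      pointwise⇒bisimilar (λ n → dyn-pointwise P h g g' always n x≡x' i i')
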